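{- Let $k\ge4$, $2\le m\le\infty$, $q:=\lceil k/m\rceil$ (with $\lceil k/\infty\rceil:=1$), and $n\ge k+q$. Let $w:=\min\{k,\lfloor n/2\rfloor\}$. If $2\le\ell\le w$, then $|\mathcal{V}(\ell)|\ge\binom{n-1}{\ell-1}-\binom{n-\ell-1}{\ell-1}+1$. Moreover, if $\ell\neq w$, then $|\mathcal{V}(\ell)|>\binom{n-1}{\ell-1}-\binom{n-\ell-1}{\ell-1}+1$.
   Context: Let $\mathcal{P}$ be the family of nonempty proper subsets of $[n]=\{1,\dots,n\}$. For $B\in\mathcal{P}$ let $B^c=[n]\setminus B$, and for $\mathcal{B}\subseteq\mathcal{P}$ let $\mathcal{B}^c=\{B^c:B\in\mathcal{B}\}$ and $\mathcal{B}(i)=\{B\in\mathcal{B}:|B|=i\}$. Let $\mathcal{U}=\{B\in\mathcal{P}:1\in B\}$, $\mathcal{R}=\{B\in\mathcal{U}:B\subseteq\{1,\dots,n-k\}\}$, and $\mathcal{V}=(\mathcal{U}\setminus\mathcal{R})\cup\mathcal{R}^c$. -}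

module Defs where

open import Data.Bool using (Bool; true; false; _∧_; _∨_; not)
open import Data.Nat using (ℕ; zero; suc; _+_; _∸_; _/_; _<ᵇ_; _≤ᵇ_; _≡ᵇ_; NonZero)
open import Data.Maybe using (Maybe; just; nothing)
open import Data.Fin using (Fin; toℕ)
open import Data.Fin.Subset using (Subset; ∣_∣; ∁)
open import Data.Vec using (Vec; []; _∷_; lookup)
open import Data.List using (List; []; _∷_; map; _++_; length; filterᵇ; allFin)
open import Data.Bool.ListAction using (and; or)

-- Subsets of [n] = {1,..,n} are Subset n = Vec Bool n; position i : Fin n
-- stands for the element toℕ i + 1 of [n].

-- Extended natural m ∈ {2,3,...} ∪ {∞}: nothing = ∞.
ℕ∞ : Set
ℕ∞ = Maybe ℕ

two≤ : ℕ∞ → Set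
two≤ (just m) = 2 Data.Nat.≤ m
two≤ nothing  = Data.Unit.⊤
  where import Data.Unit

ceilDiv : ℕ → ℕ → ℕ
ceilDiv k zero    = 0   -- never used (m ≥ 2)
ceilDiv k (suc m) = (k + m) / suc m

qOf : ℕ → ℕ∞ → ℕ
qOf k (just m) = ceilDiv k m
qOf k nothing  = 1

allSubsets : (n : ℕ) → List (Subset n)
allSubsets zero    = [] ∷ []
allSubsets (suc n) = map (true ∷_) (allSubsets n) ++ map (false ∷_) (allSubsets n)

module _ {n : ℕ} where
  inP : Subset n → Bool
  inP B = (0 <ᵇ ∣ B ∣) ∧ (∣ B ∣ <ᵇ n)

  has1 : Subset n → Bool
  has1 B = or (map (λ i → (toℕ i ≡ᵇ 0) ∧ lookup B i) (allFin n))

  inU : Subset n → Bool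
  inU B = inP B ∧ has1 B

  within : ℕ → Subset n → Bool
  within k B = and (map (λ i → not (lookup B i) ∨ (suc (toℕ i) ≤ᵇ n ∸ k)) (allFin n))

  inR : ℕ → Subset n → Bool
  inR k B = inU B ∧ within k B

  -- B ∈ ℛᶜ  iff  B = Cᶜ for some C ∈ ℛ  iff  Bᶜ ∈ ℛ
  inRc : ℕ → Subset n → Bool
  inRc k B = inR k (∁ B)

  inV : ℕ → Subset n → Bool
  inV k B = (inU B ∧ not (inR k B)) ∨ inRc k B

cardV : (n k ℓ : ℕ) → ℕ
cardV n k ℓ = length (filterᵇ (λ B → inV k B ∧ (∣ B ∣ ≡ᵇ ℓ)) (allSubsets n))

-- Split 𝒱(ℓ) according to whether 1 ∈ B. The members containing 1 are exactly
-- 𝒰(ℓ) ∖ ℛ(ℓ), of size C(n-1, ℓ-1) - C(n-k-1, ℓ-1); when ℓ = k the set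
-- {n-k+1, …, n} is a further member, its complement lying in ℛ. It remains to
-- compare C(n-k-1, ℓ-1) with C(n-ℓ-1, ℓ-1) by Pascal's rule: they agree for ℓ = k,
-- while for ℓ < k the second is larger by at least 1, and by at least 2 when also
-- ℓ < n/2 (which for ℓ = 2 needs k ≥ 4).

module Submission where

open import Defs
open import Data.Nat using (ℕ; _+_; _∸_; _/_; _≤_; _<_; _⊓_)
open import Data.Nat.Combinatorics using (_C_)
open import Relation.Binary.PropositionalEquality using (_≢_)
open import Data.Product using (_×_)

open import Data.Bool using (Bool; true; false; _∧_; _∨_; not; T; T?)
open import Data.Bool.Properties using (T-∧; ∧-zeroʳ; ∨-zeroʳ)
open import Data.Bool.ListAction using (and)
open import Data.Fin using (Fin; toℕ)
import Data.Fin as Fin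
open import Data.Fin.Subset using (Subset; ∣_∣; ∁)
open import Data.Fin.Subset.Properties using (∣∁p∣≡n∸∣p∣)
open import Data.List using (List; []; _∷_; map; _++_; length; filterᵇ; tabulate; allFin)
open import Data.List.Properties using (length-++; filter-++; map-tabulate)
open import Data.Maybe using (just; nothing)
open import Data.Nat using (zero; suc; _*_; _≡ᵇ_; _<ᵇ_; z≤n; s≤s; _≤′_; ≤′-refl; ≤′-step)
open import Data.Nat.Combinatorics using (nCk+nC[k+1]≡[n+1]C[k+1]; nC1≡n)
open import Data.Nat.DivMod using (m/n*n≤m; m≥n⇒m/n>0)
open import Data.Nat.Properties
open import Data.Product using (_,_)
open import Data.Sum using (inj₁; inj₂)
open import Data.Unit using (tt)
open import Data.Vec using ([]; _∷_; lookup)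
open import Function using (id; _∘_; Equivalence)
open import Relation.Binary.PropositionalEquality
  using (_≡_; refl; sym; trans; cong; cong₂; subst; subst₂; module ≡-Reasoning)
open import Relation.Nullary using (contradiction)

countᵇ : {A : Set} → (A → Bool) → List A → ℕ
countᵇ p = length ∘ filterᵇ p

module _ {A : Set} where

  countᵇ-++ : ∀ (p : A → Bool) xs ys → countᵇ p (xs ++ ys) ≡ countᵇ p xs + countᵇ p ys
  countᵇ-++ p xs ys = trans (cong length (filter-++ (T? ∘ p) xs ys)) (length-++ (filterᵇ p xs))

  countᵇ-false : ∀ (xs : List A) → countᵇ (λ _ → false) xs ≡ 0
  countᵇ-false []       = refl
  countᵇ-false (x ∷ xs) = countᵇ-false xs

  countᵇ-≗ : ∀ {p q : A → Bool} → (∀ x → p x ≡ q x) → ∀ xs → countᵇ p xs ≡ countᵇ q xs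
  countᵇ-≗ p≗q []       = refl
  countᵇ-≗ {p} {q} p≗q (x ∷ xs) with p x | q x | p≗q x
  ... | true  | .true  | refl = cong suc (countᵇ-≗ p≗q xs)
  ... | false | .false | refl = countᵇ-≗ p≗q xs

  countᵇ-mono : ∀ {p q : A → Bool} → (∀ x → T (p x) → T (q x)) → ∀ xs → countᵇ p xs ≤ countᵇ q xs
  countᵇ-mono p⇒q []       = z≤n
  countᵇ-mono {p} {q} p⇒q (x ∷ xs) with p x | q x | p⇒q x
  ... | true  | true  | _  = s≤s (countᵇ-mono p⇒q xs)
  ... | true  | false | pq = contradiction (pq tt) λ ()
  ... | false | true  | _  = m≤n⇒m≤1+n (countᵇ-mono p⇒q xs)
  ... | false | false | _  = countᵇ-mono p⇒q xs

  countᵇ-split : ∀ (r p : A → Bool) xs →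
    countᵇ p xs ≡ countᵇ (λ x → r x ∧ p x) xs + countᵇ (λ x → not (r x) ∧ p x) xs
  countᵇ-split r p []       = refl
  countᵇ-split r p (x ∷ xs) with r x | p x
  ... | true  | true  = cong suc (countᵇ-split r p xs)
  ... | true  | false = countᵇ-split r p xs
  ... | false | true  = trans (cong suc (countᵇ-split r p xs)) (sym (+-suc _ _))
  ... | false | false = countᵇ-split r p xs

  countᵇ-map : ∀ {B : Set} (p : A → Bool) (f : B → A) xs → countᵇ p (map f xs) ≡ countᵇ (p ∘ f) xs
  countᵇ-map p f []       = refl
  countᵇ-map p f (x ∷ xs) with p (f x)
  ... | true  = cong suc (countᵇ-map p f xs)
  ... | false = countᵇ-map p f xs

countᵇ-allSubsets-suc : ∀ {n} (p : Subset (suc n) → Bool) →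
  countᵇ p (allSubsets (suc n))
    ≡ countᵇ (p ∘ (true ∷_)) (allSubsets n) + countᵇ (p ∘ (false ∷_)) (allSubsets n)
countᵇ-allSubsets-suc {n} p =
  trans (countᵇ-++ p (map (true ∷_) S) (map (false ∷_) S))
        (cong₂ _+_ (countᵇ-map p (true ∷_) S) (countᵇ-map p (false ∷_) S))
  where
  S : List (Subset n)
  S = allSubsets n

0<countᵇ-allSubsets : ∀ {n} (p : Subset n → Bool) (B : Subset n) → T (p B) → 0 < countᵇ p (allSubsets n)
0<countᵇ-allSubsets p [] pB with p []
... | true = s≤s z≤n
0<countᵇ-allSubsets p (true ∷ B) pB rewrite countᵇ-allSubsets-suc p =
  ≤-trans (0<countᵇ-allSubsets (p ∘ (true ∷_)) B pB) (m≤m+n _ _)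
0<countᵇ-allSubsets p (false ∷ B) pB rewrite countᵇ-allSubsets-suc p =
  ≤-trans (0<countᵇ-allSubsets (p ∘ (false ∷_)) B pB) (m≤n+m _ _)

-- Elements are numbered from 0, so boundedBy t B below says B ⊆ {1, …, t}.
allElems : ∀ {n} → (ℕ → Bool) → Subset n → Bool
allElems f []      = true
allElems f (b ∷ B) = (not b ∨ f 0) ∧ allElems (f ∘ suc) B

boundedBy : ∀ {n} → ℕ → Subset n → Bool
boundedBy t = allElems (_<ᵇ t)

within≡boundedBy : ∀ {n} k (B : Subset n) → within k B ≡ boundedBy (n ∸ k) B
within≡boundedBy {n} k = and-allFin≡allElems (_<ᵇ n ∸ k)
  where
  and-allFin≡allElems : ∀ {n} (f : ℕ → Bool) (B : Subset n) →
    and (map (λ i → not (lookup B i) ∨ f (toℕ i)) (allFin n)) ≡ allElems f B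
  and-allFin≡allElems f [] = refl
  and-allFin≡allElems {suc n} f (b ∷ B) = cong ((not b ∨ f 0) ∧_) (begin
    and (map g (tabulate Fin.suc))         ≡⟨ cong and (map-tabulate Fin.suc g) ⟩
    and (tabulate (g ∘ Fin.suc))           ≡⟨ cong and (map-tabulate id (g ∘ Fin.suc)) ⟨
    and (map (g ∘ Fin.suc) (allFin n))     ≡⟨ and-allFin≡allElems (f ∘ suc) B ⟩
    allElems (f ∘ suc) B                   ∎)
    where
    open ≡-Reasoning
    g : Fin (suc n) → Bool
    g i = not (lookup (b ∷ B) i) ∨ f (toℕ i)

boundedBy-full : ∀ {n} (B : Subset n) → boundedBy n B ≡ true
boundedBy-full []      = refl
boundedBy-full (b ∷ B) = cong₂ _∧_ (∨-zeroʳ (not b)) (boundedBy-full B)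

countᵇ-boundedBy-size : ∀ n t j → t ≤ n →
  countᵇ (λ B → boundedBy t B ∧ (∣ B ∣ ≡ᵇ j)) (allSubsets n) ≡ t C j
countᵇ-boundedBy-size zero    zero    zero    z≤n = refl
countᵇ-boundedBy-size zero    zero    (suc j) z≤n = refl
countᵇ-boundedBy-size (suc n) zero    j       z≤n =
  trans (countᵇ-allSubsets-suc {n} _)
        (cong₂ _+_ (countᵇ-false (allSubsets n)) (countᵇ-boundedBy-size n zero j z≤n))
countᵇ-boundedBy-size (suc n) (suc t) zero    (s≤s t≤n) =
  trans (countᵇ-allSubsets-suc {n} _)
        (cong₂ _+_ (trans (countᵇ-≗ (λ B → ∧-zeroʳ (boundedBy t B)) (allSubsets n)) (countᵇ-false (allSubsets n)))
                   (countᵇ-boundedBy-size n t zero t≤n))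
countᵇ-boundedBy-size (suc n) (suc t) (suc j) (s≤s t≤n) =
  trans (countᵇ-allSubsets-suc {n} _)
        (trans (cong₂ _+_ (countᵇ-boundedBy-size n t j t≤n) (countᵇ-boundedBy-size n t (suc j) t≤n))
               (nCk+nC[k+1]≡[n+1]C[k+1] t j))

countᵇ-size : ∀ n j → countᵇ (λ B → ∣ B ∣ ≡ᵇ j) (allSubsets n) ≡ n C j
countᵇ-size n j =
  trans (sym (countᵇ-≗ (λ B → cong (_∧ (∣ B ∣ ≡ᵇ j)) (boundedBy-full B)) (allSubsets n)))
        (countᵇ-boundedBy-size n n j ≤-refl)

countᵇ-unbounded-size : ∀ {n t} j → t ≤ n →
  countᵇ (λ B → not (boundedBy t B) ∧ (∣ B ∣ ≡ᵇ j)) (allSubsets n) + t C j ≡ n C j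
countᵇ-unbounded-size {n} {t} j t≤n = begin
  unbounded + t C j               ≡⟨ +-comm unbounded (t C j) ⟩
  t C j + unbounded               ≡⟨ cong (_+ unbounded) (countᵇ-boundedBy-size n t j t≤n) ⟨
  bounded + unbounded             ≡⟨ countᵇ-split (boundedBy t) (λ B → ∣ B ∣ ≡ᵇ j) (allSubsets n) ⟨
  countᵇ (λ B → ∣ B ∣ ≡ᵇ j) (allSubsets n) ≡⟨ countᵇ-size n j ⟩
  n C j                           ∎
  where
  open ≡-Reasoning
  bounded unbounded : ℕ
  bounded   = countᵇ (λ B → boundedBy t B ∧ (∣ B ∣ ≡ᵇ j)) (allSubsets n)
  unbounded = countᵇ (λ B → not (boundedBy t B) ∧ (∣ B ∣ ≡ᵇ j)) (allSubsets n)

upper : ℕ → (n : ℕ) → Subset n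
upper t       zero    = []
upper zero    (suc n) = true ∷ upper zero n
upper (suc t) (suc n) = false ∷ upper t n

∣upper∣ : ∀ t n → ∣ upper t n ∣ ≡ n ∸ t
∣upper∣ t       zero    = sym (0∸n≡0 t)
∣upper∣ zero    (suc n) = cong suc (∣upper∣ zero n)
∣upper∣ (suc t) (suc n) = ∣upper∣ t n

∣∁upper∣ : ∀ {t n} → t ≤ n → ∣ ∁ (upper t n) ∣ ≡ t
∣∁upper∣ {t} {n} t≤n = trans (∣∁p∣≡n∸∣p∣ (upper t n)) (trans (cong (n ∸_) (∣upper∣ t n)) (m∸[m∸n]≡n t≤n))

boundedBy-∁upper : ∀ t n → boundedBy t (∁ (upper t n)) ≡ true
boundedBy-∁upper t       zero    = refl
boundedBy-∁upper zero    (suc n) = boundedBy-∁upper zero n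
boundedBy-∁upper (suc t) (suc n) = boundedBy-∁upper t n

inV-of-U∖R : ∀ {n} k (B : Subset n) → T (inU B) → T (not (within k B)) → T (inV k B)
inV-of-U∖R k B = lemma (inU B) (within k B) (inRc k B)
  where
  lemma : ∀ u w r → T u → T (not w) → T ((u ∧ not (u ∧ w)) ∨ r)
  lemma true false r _ _ = tt

inV-of-Rᶜ : ∀ {n} k (B : Subset n) → T (inU (∁ B)) → T (within k (∁ B)) → T (inV k B)
inV-of-Rᶜ k B = lemma (inU B ∧ not (inR k B)) (inU (∁ B)) (within k (∁ B))
  where
  lemma : ∀ a u w → T u → T w → T (a ∨ (u ∧ w))
  lemma true  true true _ _ = tt
  lemma false true true _ _ = tt

inU-true∷ : ∀ {n} (B : Subset n) → ∣ B ∣ < n → T (inU (true ∷ B))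
inU-true∷ B ∣B∣<n = Equivalence.from T-∧ (<⇒<ᵇ ∣B∣<n , tt)

within-true∷ : ∀ {n} k (B : Subset n) → k ≤ n → within k (true ∷ B) ≡ boundedBy (n ∸ k) B
within-true∷ k B k≤n =
  trans (within≡boundedBy k (true ∷ B)) (cong (λ t → boundedBy t (true ∷ B)) (+-∸-assoc 1 k≤n))

cardV∋1 cardV∌1 : (n k ℓ : ℕ) → ℕ
cardV∋1 n k ℓ = countᵇ (λ B → inV k (true ∷ B) ∧ (∣ true ∷ B ∣ ≡ᵇ ℓ)) (allSubsets n)
cardV∌1 n k ℓ = countᵇ (λ B → inV k (false ∷ B) ∧ (∣ false ∷ B ∣ ≡ᵇ ℓ)) (allSubsets n)

cardV-suc : ∀ n k ℓ → cardV (suc n) k ℓ ≡ cardV∋1 n k ℓ + cardV∌1 n k ℓ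
cardV-suc n k ℓ = countᵇ-allSubsets-suc {n} _

-- On [N] with N = n + 1: {1} ∪ B lies in 𝒰 ∖ ℛ as soon as B ⊄ {2, …, N - k}.
countᵇ-unbounded≤cardV∋1 : ∀ {n k j} → k ≤ n → j < n →
  countᵇ (λ B → not (boundedBy (n ∸ k) B) ∧ (∣ B ∣ ≡ᵇ j)) (allSubsets n) ≤ cardV∋1 n k (suc j)
countᵇ-unbounded≤cardV∋1 {n} {k} {j} k≤n j<n = countᵇ-mono member (allSubsets n)
  where
  member : ∀ B → T (not (boundedBy (n ∸ k) B) ∧ (∣ B ∣ ≡ᵇ j)) →
    T (inV k (true ∷ B) ∧ (∣ B ∣ ≡ᵇ j))
  member B h with Equivalence.to T-∧ h
  ... | unbounded , sized = Equivalence.from T-∧ (inV-of-U∖R k (true ∷ B) inU[1∪B] notR , sized)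
    where
    inU[1∪B] : T (inU (true ∷ B))
    inU[1∪B] = inU-true∷ B (subst (_< n) (sym (≡ᵇ⇒≡ ∣ B ∣ j sized)) j<n)
    notR : T (not (within k (true ∷ B)))
    notR = subst (T ∘ not) (sym (within-true∷ k B k≤n)) unbounded

-- On [N] with N = n + 1: {N - k + 1, …, N} lies in ℛᶜ.
0<cardV∌1 : ∀ {n k} → 0 < k → k ≤ n → 0 < cardV∌1 n k k
0<cardV∌1 {n} {k} 0<k k≤n = 0<countᵇ-allSubsets _ B
  (Equivalence.from T-∧ (inV-of-Rᶜ k (false ∷ B) inU[∁B] R[∁B] , ≡⇒≡ᵇ ∣ B ∣ k ∣B∣≡k))
  where
  B : Subset n
  B = upper (n ∸ k) n
  ∣B∣≡k : ∣ B ∣ ≡ k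
  ∣B∣≡k = trans (∣upper∣ (n ∸ k) n) (m∸[m∸n]≡n k≤n)
  inU[∁B] : T (inU (true ∷ ∁ B))
  inU[∁B] = inU-true∷ (∁ B) (subst (_< n) (sym (∣∁upper∣ (m∸n≤m n k))) (∸-monoʳ-< 0<k k≤n))
  R[∁B] : T (within k (true ∷ ∁ B))
  R[∁B] = subst T (sym (trans (within-true∷ k (∁ B) k≤n) (boundedBy-∁upper (n ∸ k) n))) tt

cardV-lower : ∀ {n k j} → k ≤ n → j < n →
  n C j + cardV∌1 n k (suc j) ≤ cardV (suc n) k (suc j) + (n ∸ k) C j
cardV-lower {n} {k} {j} k≤n j<n = begin
  n C j + F                  ≡⟨ cong (_+ F) (countᵇ-unbounded-size j (m∸n≤m n k)) ⟨
  U + t C j + F              ≡⟨ +-assoc U (t C j) F ⟩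
  U + (t C j + F)            ≡⟨ cong (U +_) (+-comm (t C j) F) ⟩
  U + (F + t C j)            ≡⟨ +-assoc U F (t C j) ⟨
  U + F + t C j              ≤⟨ +-monoˡ-≤ (t C j) (+-monoˡ-≤ F (countᵇ-unbounded≤cardV∋1 k≤n j<n)) ⟩
  cardV∋1 n k (suc j) + F + t C j ≡⟨ cong (_+ t C j) (cardV-suc n k (suc j)) ⟨
  cardV (suc n) k (suc j) + t C j ∎
  where
  open ≤-Reasoning
  t F U : ℕ
  t = n ∸ k
  F = cardV∌1 n k (suc j)
  U = countᵇ (λ B → not (boundedBy t B) ∧ (∣ B ∣ ≡ᵇ j)) (allSubsets n)

C-suc-monoˡ : ∀ n r → n C r ≤ suc n C r
C-suc-monoˡ n zero    = ≤-refl
C-suc-monoˡ n (suc r) = subst (n C suc r ≤_) (nCk+nC[k+1]≡[n+1]C[k+1] n r) (m≤n+m _ _)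

C-monoˡ-≤ : ∀ {m n} r → m ≤ n → m C r ≤ n C r
C-monoˡ-≤ {m} r m≤n = go (≤⇒≤′ m≤n)
  where
  go : ∀ {n} → m ≤′ n → m C r ≤ n C r
  go ≤′-refl        = ≤-refl
  go (≤′-step m≤′n) = ≤-trans (go m≤′n) (C-suc-monoˡ _ r)

0<C : ∀ {n r} → r ≤ n → 0 < n C r
0<C {n}     {zero}  _         = s≤s z≤n
0<C {suc n} {suc r} (s≤s r≤n) =
  subst (0 <_) (nCk+nC[k+1]≡[n+1]C[k+1] n r) (≤-trans (0<C r≤n) (m≤m+n _ _))

2≤C : ∀ {n r} → 0 < r → r < n → 2 ≤ n C r
2≤C {suc n} {suc r} _ (s≤s r<n) =
  subst (2 ≤_) (nCk+nC[k+1]≡[n+1]C[k+1] n r) (+-mono-≤ (0<C (<⇒≤ r<n)) (0<C r<n))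

C-monoˡ-< : ∀ {m n r} → m < n → 0 < r → r ≤ n → m C r < n C r
C-monoˡ-< {m} {suc n} {suc r} (s≤s m≤n) _ (s≤s r≤n) =
  subst (suc (m C suc r) ≤_) (nCk+nC[k+1]≡[n+1]C[k+1] n r) (+-mono-≤ (0<C r≤n) (C-monoˡ-≤ (suc r) m≤n))

C-monoˡ-<₂ : ∀ {m n r} → m < n → 1 < r → r < n → 2 + m C r ≤ n C r
C-monoˡ-<₂ {m} {suc n} {suc r} (s≤s m≤n) (s≤s 0<r) (s≤s r<n) =
  subst (2 + m C suc r ≤_) (nCk+nC[k+1]≡[n+1]C[k+1] n r) (+-mono-≤ (2≤C 0<r r<n) (C-monoˡ-≤ (suc r) m≤n))

≤-shift : ∀ {x y z w} c → x ≤ y + z → c + z ≤ w → x + c ≤ y + w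
≤-shift {x} {y} {z} {w} c x≤y+z c+z≤w = begin
  x + c        ≤⟨ +-monoˡ-≤ c x≤y+z ⟩
  y + z + c    ≡⟨ +-assoc y z c ⟩
  y + (z + c)  ≡⟨ cong (y +_) (+-comm z c) ⟩
  y + (c + z)  ≤⟨ +-monoʳ-≤ y c+z≤w ⟩
  y + w        ∎
  where open ≤-Reasoning

m≤n/2⇒m+m≤n : ∀ {m} n → m ≤ n / 2 → m + m ≤ n
m≤n/2⇒m+m≤n {m} n m≤n/2 = begin
  m + m        ≡⟨ cong (m +_) (+-identityʳ m) ⟨
  2 * m        ≤⟨ *-monoʳ-≤ 2 m≤n/2 ⟩
  2 * (n / 2)  ≡⟨ *-comm 2 (n / 2) ⟩
  n / 2 * 2    ≤⟨ m/n*n≤m n 2 ⟩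
  n            ∎
  where open ≤-Reasoning

0<qOf : ∀ {k} m → 0 < k → two≤ m → 0 < qOf k m
0<qOf nothing         _   _  = s≤s z≤n
0<qOf (just zero)     _   ()
0<qOf (just (suc m)) 0<k _  = m≥n⇒m/n>0 (+-monoˡ-≤ m 0<k)

-- For j = 1 the binomials are n - k and n - 2, and the gap of 2 needs k ≥ 4.
tail-gap₂ : ∀ {n k j} → 4 ≤ k → k ≤ n → suc j < k → 0 < j → suc j < n ∸ suc j →
  2 + (n ∸ k) C j ≤ (n ∸ suc j) C j
tail-gap₂ {n} {k} {1} 4≤k k≤n _ _ _ =
  subst₂ (λ x y → 2 + x ≤ y) (sym (nC1≡n (n ∸ k))) (sym (nC1≡n (n ∸ 2)))
    (≤-trans (s≤s (∸-monoʳ-< 4≤k k≤n)) (∸-monoʳ-< ≤-refl (≤-trans (n≤1+n 3) (≤-trans 4≤k k≤n))))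
tail-gap₂ {j = suc (suc r)} _ k≤n ℓ<k _ ℓ<a = C-monoˡ-<₂ (∸-monoʳ-< ℓ<k k≤n) (s≤s (s≤s z≤n)) (<-trans (n<1+n _) ℓ<a)

cardV-bound : ∀ {n k j} → k ≤ n → 0 < j → suc j ≤ k → j ≤ n ∸ suc j →
  n C j + 1 ≤ cardV (suc n) k (suc j) + (n ∸ suc j) C j
cardV-bound {n} {k} {j} k≤n 0<j ℓ≤k j≤a with m≤n⇒m<n∨m≡n ℓ≤k
... | inj₂ refl = ≤-trans (+-monoʳ-≤ (n C j) (0<cardV∌1 (s≤s z≤n) k≤n)) (cardV-lower k≤n k≤n)
... | inj₁ ℓ<k  = ≤-shift 1 (≤-trans (m≤m+n _ _) (cardV-lower k≤n (≤-trans ℓ≤k k≤n)))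
                           (C-monoˡ-< (∸-monoʳ-< ℓ<k k≤n) 0<j j≤a)

cardV-bound-strict : ∀ {n k j} → 4 ≤ k → k ≤ n → suc j < k → 0 < j → suc j < n ∸ suc j →
  n C j + 1 < cardV (suc n) k (suc j) + (n ∸ suc j) C j
cardV-bound-strict {n} {k} {j} 4≤k k≤n ℓ<k 0<j ℓ<a =
  subst (_≤ cardV (suc n) k (suc j) + (n ∸ suc j) C j) (+-suc (n C j) 1)
    (≤-shift 2 (≤-trans (m≤m+n _ _) (cardV-lower k≤n (≤-trans (<⇒≤ ℓ<k) k≤n)))
               (tail-gap₂ 4≤k k≤n ℓ<k 0<j ℓ<a))

lemma2p2 : (k : ℕ) (m : ℕ∞) (n ℓ : ℕ) →
    4 ≤ k → two≤ m → k + qOf k m ≤ n →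
    2 ≤ ℓ → ℓ ≤ k ⊓ (n / 2) →
    ((n ∸ 1) C (ℓ ∸ 1) + 1 ≤ cardV n k ℓ + (n ∸ ℓ ∸ 1) C (ℓ ∸ 1))
    × (ℓ ≢ k ⊓ (n / 2) →
       (n ∸ 1) C (ℓ ∸ 1) + 1 < cardV n k ℓ + (n ∸ ℓ ∸ 1) C (ℓ ∸ 1))
lemma2p2 k m zero    (suc j) _ _ _ _ ℓ≤w = contradiction (≤-trans ℓ≤w (m⊓n≤n k 0)) λ ()
lemma2p2 k m (suc n) (suc j) 4≤k 2≤m k+q≤n (s≤s 0<j) ℓ≤w rewrite pred[m∸n]≡m∸[1+n] n j =
  cardV-bound k≤n 0<j ℓ≤k (m+n≤o⇒m≤o∸n j (≤-pred (m≤n/2⇒m+m≤n (suc n) ℓ≤n/2))) ,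
  λ ℓ≢w → cardV-bound-strict 4≤k k≤n (ℓ<k ℓ≢w) 0<j (ℓ<n∸ℓ ℓ≢w)
  where
  k≤n : k ≤ n
  k≤n = ≤-pred (<-≤-trans (m<m+n k (0<qOf m (≤-trans (s≤s z≤n) 4≤k) 2≤m)) k+q≤n)
  ℓ≤k : suc j ≤ k
  ℓ≤k = ≤-trans ℓ≤w (m⊓n≤m k _)
  ℓ≤n/2 : suc j ≤ suc n / 2
  ℓ≤n/2 = ≤-trans ℓ≤w (m⊓n≤n k _)
  ℓ<w : suc j ≢ k ⊓ (suc n / 2) → suc j < k ⊓ (suc n / 2)
  ℓ<w = ≤∧≢⇒< ℓ≤w
  ℓ<k : suc j ≢ k ⊓ (suc n / 2) → suc j < k
  ℓ<k ℓ≢w = ≤-trans (ℓ<w ℓ≢w) (m⊓n≤m k _)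
  ℓ<n∸ℓ : suc j ≢ k ⊓ (suc n / 2) → suc j < n ∸ suc j
  ℓ<n∸ℓ ℓ≢w = m+n≤o⇒m≤o∸n (suc (suc j))
    (subst (_≤ n) (+-comm (suc j) (suc (suc j)))
      (≤-pred (m≤n/2⇒m+m≤n (suc n) (≤-trans (ℓ<w ℓ≢w) (m⊓n≤n k _)))))
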